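{- Let $p$ be an odd prime, $L=\langle -1,2\rangle\le\mathbb{Z}_p^{\times}$, $\ell=[\mathbb{Z}_p^{\times}:L]$, and assume $\ell\ge3$. Let $g$ be a primitive root of $\mathbb{Z}_p$ and $A(i,j)=|(1+g^iL)\cap g^jL|$ for integers $i,j$. Then the number of squares of $\mathbb{Z}_p$ (including $0$) lying in $1+L$ is $$\frac12+\frac12\sum_{i=0}^{\ell-1}A(i,-i),$$ and for each $1\le k\le\ell-1$, the number of squares of $\mathbb{Z}_p$ lying in $1+g^kL$ is $$\frac12\sum_{i=0}^{\ell-1}A(i,k-i).$$
   Context: $\mathbb{Z}_p=\mathbb{Z}/p\mathbb{Z}$, $\mathbb{Z}_p^{\times}=\mathbb{Z}_p\setminus\{0\}$; $\langle -1,2\rangle$ is the subgroup generated by $-1$ and $2$. A primitive root is a generator of $\mathbb{Z}_p^{\times}$. An element $x\in\mathbb{Z}_p$ is a square if $x=r^2$ for some $r\in\mathbb{Z}_p$. For $S\subseteq\mathbb{Z}_p$, $a+S=\{a+s:s\in S\}$, $aS=\{as:s\in S\}$. -}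

module Defs where

open import Data.Nat using (ℕ; suc)
open import Data.Integer using (ℤ; +_; -[1+_]; _-_; _+_; _*_; _^_; -_)
open import Data.Integer.Divisibility using (_∣_)
open import Data.Fin using (Fin; toℕ)
open import Data.List using (List; length; map; upTo)
open import Data.Nat.ListAction using (sum)
open import Data.List.Relation.Unary.Unique.Propositional using (Unique)
open import Data.List.Membership.Propositional using (_∈_)
open import Data.Product using (Σ; ∃; _×_)
open import Relation.Nullary using (¬_)
open import Function.Bundles using (_⇔_)
open import Relation.Binary.PropositionalEquality using (_≡_)

_≡_[mod_] : ℤ → ℤ → ℕ → Set
x ≡ y [mod p ] = (+ p) ∣ (x - y)

-- Elements of Z_p are represented by integers, equality being congruence mod p.

InL : ℕ → ℤ → Set
InL p x = ∃ λ a → ∃ λ b → x ≡ ((- (+ 1)) ^ a) * ((+ 2) ^ b) [mod p ]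

-- x = g^j · y in Z_p^× (for j ∈ ℤ; negative powers via the inverse:
-- x = g^{-(n+1)} y  iff  y = g^{n+1} x).
PowMul : ℕ → ℤ → ℤ → ℤ → ℤ → Set
PowMul p g (+ n)     y x = x ≡ (g ^ n) * y [mod p ]
PowMul p g -[1+ n ]  y x = y ≡ (g ^ suc n) * x [mod p ]

InCoset : ℕ → ℤ → ℤ → ℤ → Set
InCoset p g j x = ∃ λ y → InL p y × PowMul p g j y x

InShift1 : ℕ → (ℤ → Set) → ℤ → Set
InShift1 p S x = ∃ λ s → S s × (x ≡ + 1 + s [mod p ])

IsSquare : ℕ → ℤ → Set
IsSquare p x = ∃ λ (r : Fin p) → x ≡ (+ toℕ r) * (+ toℕ r) [mod p ]

PrimitiveRoot : ℕ → ℤ → Set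
PrimitiveRoot p g =
  ¬ (g ≡ + 0 [mod p ]) ×
  ((x : ℤ) → ¬ (x ≡ + 0 [mod p ]) → ∃ λ n → x ≡ g ^ n [mod p ])

NonZeroRes : ℕ → ℤ → Set
NonZeroRes p x = ¬ (x ≡ + 0 [mod p ])

Count : (p : ℕ) → (ℤ → Set) → ℕ → Set
Count p P n = Σ (List (Fin p)) λ xs →
  Unique xs × ((r : Fin p) → (r ∈ xs) ⇔ P (+ toℕ r)) × length xs ≡ n

sumTo : ℕ → (ℕ → ℕ) → ℕ
sumTo ℓ f = sum (map f (upTo ℓ))

{-# OPTIONS --safe #-}

-- The cosets g^i L (0 ≤ i < ℓ) partition ℤₚ^×, so
-- Σᵢ A(i, k - i) counts the x with x - 1 ∈ g^i L and x ∈ g^(k-i) L for some i, that is, the x with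
-- (x - 1) x ∈ g^k L. Since 4 ∈ L and 4 (x - 1) x = (2x - 1)² - 1, the substitution r = 2x - 1 turns
-- this into the number of r with r² - 1 ∈ g^k L. Every nonzero square s with s - 1 ∈ g^k L has exactly
-- two such square roots ±r, while the square 0 has the single root 0 and counts iff -1 ∈ g^k L, that is,
-- iff k = 0 (as -1 ∈ L). Hence twice the number of squares is [k = 0] + Σᵢ A(i, k - i).

module Submission where

open import Defs

open import Data.Empty using (⊥-elim)
open import Data.Fin as Fin using (Fin; toℕ)
import Data.Fin.Properties as Finₚ
open import Data.Integer using (ℤ; +_; -[1+_]; _-_; -_; _^_; ∣_∣)
open import Data.Integer.Divisibility.Signed
  using (_∣_; divides; ∣ᵤ⇒∣; ∣⇒∣ᵤ; ∣-refl; ∣m⇒∣-m; ∣m∣n⇒∣m+n; ∣m⇒∣m*n; ∣n⇒∣m*n)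
open import Data.Integer.DivMod using (_%ℕ_; _/ℕ_; n%ℕd<d; a≡a%ℕn+[a/ℕn]*n)
import Data.Integer.Properties as ℤₚ
open import Data.Integer.Tactic.RingSolver using (solve-∀)
open import Data.List using ([]; _∷_; _++_; [_]; map; filter; allFin; upTo)
open import Data.List.Properties using (length-++; length-map; length-tabulate; map-++; map-cong; upTo-∷ʳ)
open import Data.List.Membership.Propositional using (_∈_)
open import Data.List.Membership.Propositional.Properties
  using (∈-filter⁺; ∈-filter⁻; ∈-++⁺ˡ; ∈-++⁺ʳ; ∈-++⁻; ∈-map⁺; ∈-map⁻; ∈-allFin)
open import Data.List.Membership.Propositional.Properties.WithK using (unique∧set⇒bag)
open import Data.List.Relation.Binary.BagAndSetEquality using (∼bag⇒↭)
open import Data.List.Relation.Binary.Permutation.Propositional.Properties using (↭-length)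
open import Data.List.Relation.Unary.All as All using (All; []; _∷_)
import Data.List.Relation.Unary.All.Properties as Allₚ
open import Data.List.Relation.Unary.Any using (any?; here)
open import Data.List.Relation.Unary.Unique.Propositional using (Unique; []; _∷_)
import Data.List.Relation.Unary.Unique.Propositional.Properties as Uniqueₚ
open import Data.Nat as ℕ using (ℕ; zero; suc; _<_; _≤_; _∸_; s≤s)
open import Data.Nat.Coprimality using (prime⇒coprime; coprime-Bézout)
import Data.Nat.Divisibility as ℕ∣
import Data.Nat.DivMod as ℕDivMod
open import Data.Nat.GCD using (module Bézout)
open import Data.Nat.Induction using (<-rec)
open import Data.Nat.ListAction using (sum)
open import Data.Nat.ListAction.Properties using (sum-++)
open import Data.Nat.Primality using (Prime; prime⇒nonZero; prime⇒nonTrivial; euclidsLemma)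
import Data.Nat.Properties as ℕₚ
open import Data.Nat.Tactic.RingSolver renaming (solve-∀ to ℕ-solve-∀)
open import Data.Product as Product using (∃; _×_; _,_; proj₁; proj₂)
open import Data.Product.Function.NonDependent.Propositional using (_×-⇔_)
open import Data.Sum as Sum using (_⊎_; inj₁; inj₂; [_,_]′)
open import Data.Unit using (⊤; tt)
open import Function using (_∘_; id)
open import Function.Bundles using (_⇔_; mk⇔; Equivalence)
import Function.Properties.Equivalence as ⇔
open import Level using (0ℓ)
open import Relation.Binary.Bundles using (Setoid)
open import Relation.Binary.Definitions using (_Respects_; tri<; tri≈; tri>)
open import Relation.Binary.PropositionalEquality
  using (_≡_; _≢_; refl; sym; trans; cong; cong₂; subst; module ≡-Reasoning)
import Relation.Binary.Reasoning.Setoid as SetoidReasoning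
open import Relation.Nullary using (¬_; ¬?; Dec; yes; no)
open import Relation.Nullary.Decidable using (map′)
open import Relation.Unary using (Decidable)

open Equivalence using (to; from)

module ⇔-Reasoning = SetoidReasoning (⇔.⇔-setoid 0ℓ)

sumTo-suc : ∀ d f → sumTo (suc d) f ≡ sumTo d f ℕ.+ f d
sumTo-suc d f = begin
  sum (map f (upTo (suc d)))         ≡⟨ cong (sum ∘ map f) (sym (upTo-∷ʳ d)) ⟩
  sum (map f (upTo d ++ [ d ]))      ≡⟨ cong sum (map-++ f (upTo d) [ d ]) ⟩
  sum (map f (upTo d) ++ [ f d ])    ≡⟨ sum-++ (map f (upTo d)) [ f d ] ⟩
  sumTo d f ℕ.+ (f d ℕ.+ 0)          ≡⟨ cong (sumTo d f ℕ.+_) (ℕₚ.+-identityʳ (f d)) ⟩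
  sumTo d f ℕ.+ f d                  ∎
  where open ≡-Reasoning

sumTo-cong : ∀ d {f f′} → (∀ i → f i ≡ f′ i) → sumTo d f ≡ sumTo d f′
sumTo-cong d f≗f′ = cong sum (map-cong f≗f′ (upTo d))

sumTo-const : ∀ d c → sumTo d (λ _ → c) ≡ d ℕ.* c
sumTo-const zero    c = refl
sumTo-const (suc d) c = begin
  sumTo (suc d) (λ _ → c) ≡⟨ sumTo-suc d (λ _ → c) ⟩
  sumTo d (λ _ → c) ℕ.+ c ≡⟨ cong (ℕ._+ c) (sumTo-const d c) ⟩
  d ℕ.* c ℕ.+ c           ≡⟨ ℕₚ.+-comm (d ℕ.* c) c ⟩
  suc d ℕ.* c             ∎
  where open ≡-Reasoning

m≤n∸1⇒m<n : ∀ {m n} → 0 < m → m ≤ n ∸ 1 → m < n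
m≤n∸1⇒m<n {n = zero}  0<m m≤0 = ⊥-elim (ℕₚ.n≮0 (ℕₚ.<-≤-trans 0<m m≤0))
m≤n∸1⇒m<n {n = suc n} _   m≤n = s≤s m≤n

∃-smallest : ∀ {P : ℕ → Set} → Decidable P → ∀ {n} → P n → ∃ λ k → P k × (∀ {j} → j < k → ¬ P j)
∃-smallest {P} P? = <-rec (λ n → P n → ∃ λ k → P k × (∀ {j} → j < k → ¬ P j)) smallest-below _
  where
  smallest-below : ∀ n → (∀ {m} → m < n → P m → ∃ λ k → P k × (∀ {j} → j < k → ¬ P j)) →
                   P n → ∃ λ k → P k × (∀ {j} → j < k → ¬ P j)
  smallest-below n rec Pn with ℕₚ.anyUpTo? P? n
  ... | yes (m , m<n , Pm) = rec m<n Pm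
  ... | no  none           = n , Pn , λ j<n Pj → none (_ , j<n , Pj)

module Counting (p : ℕ) where

  infix 4 _≐_
  _≐_ : (ℤ → Set) → (ℤ → Set) → Set
  P ≐ Q = (r : Fin p) → P (+ toℕ r) ⇔ Q (+ toℕ r)

  private
    variable
      P Q : ℤ → Set
      m n : ℕ

  Count-≐ : P ≐ Q → Count p P n → Count p Q n
  Count-≐ P≐Q (xs , xs! , ∈xs⇔P , len) = xs , xs! , (λ r → ⇔.trans (∈xs⇔P r) (P≐Q r)) , len

  Count-unique : Count p P m → Count p P n → m ≡ n
  Count-unique (xs , xs! , ∈xs⇔P , refl) (ys , ys! , ∈ys⇔P , refl) =
    ↭-length (∼bag⇒↭ (unique∧set⇒bag xs! ys! λ {r} → ⇔.trans (∈xs⇔P r) (⇔.sym (∈ys⇔P r))))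

  Count-dec : Count p P n → (r : Fin p) → Dec (P (+ toℕ r))
  Count-dec (xs , _ , ∈xs⇔P , _) r = map′ (to (∈xs⇔P r)) (from (∈xs⇔P r)) (any? (r Finₚ.≟_) xs)

  Count-∅ : (∀ r → ¬ P (+ toℕ r)) → Count p P 0
  Count-∅ ¬P = [] , [] , (λ r → mk⇔ (λ ()) (⊥-elim ∘ ¬P r)) , refl

  Count-all : Count p (λ _ → ⊤) p
  Count-all = allFin p , Uniqueₚ.allFin⁺ p , (λ r → mk⇔ _ (λ _ → ∈-allFin r)) , length-tabulate {n = p} _

  Count-filter : Count p P n → ((r : Fin p) → Dec (Q (+ toℕ r))) → ∃ λ m → Count p (λ x → P x × Q x) m
  Count-filter (xs , xs! , ∈xs⇔P , _) Q? =
    _ , filter Q? xs , Uniqueₚ.filter⁺ Q? xs! ,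
    (λ r → mk⇔ (λ r∈ → let (r∈xs , Qr) = ∈-filter⁻ Q? r∈ in to (∈xs⇔P r) r∈xs , Qr)
               (λ (Pr , Qr) → ∈-filter⁺ Q? (from (∈xs⇔P r) Pr) Qr)) ,
    refl

  Count-⊎ : Count p P m → Count p Q n → (∀ r → P (+ toℕ r) → ¬ Q (+ toℕ r)) →
            Count p (λ x → P x ⊎ Q x) (m ℕ.+ n)
  Count-⊎ (xs , xs! , ∈xs⇔P , refl) (ys , ys! , ∈ys⇔Q , refl) disjoint =
    xs ++ ys ,
    Uniqueₚ.++⁺ xs! ys! (λ {r} (r∈xs , r∈ys) → disjoint r (to (∈xs⇔P r) r∈xs) (to (∈ys⇔Q r) r∈ys)) ,
    (λ r → mk⇔ ([ inj₁ ∘ to (∈xs⇔P r) , inj₂ ∘ to (∈ys⇔Q r) ]′ ∘ ∈-++⁻ xs)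
               [ ∈-++⁺ˡ ∘ from (∈xs⇔P r) , ∈-++⁺ʳ xs ∘ from (∈ys⇔Q r) ]′) ,
    length-++ xs

  Count-image : Count p P n → (f : Fin p → Fin p) →
    (∀ {r s} → P (+ toℕ r) → P (+ toℕ s) → f r ≡ f s → r ≡ s) →
    (∀ r → P (+ toℕ r) → Q (+ toℕ (f r))) →
    (∀ s → Q (+ toℕ s) → ∃ λ r → P (+ toℕ r) × f r ≡ s) →
    Count p Q n
  Count-image {P} {Q = Q} (xs , xs! , ∈xs⇔P , len) f injective-on-P f∈Q f-onto =
    map f xs , map-unique (All.tabulate (to (∈xs⇔P _))) xs! ,
    (λ s → mk⇔ image⇒Q (Q⇒image s)) , trans (length-map f xs) len
    where
    map-unique : ∀ {ys} → All (P ∘ +_ ∘ toℕ) ys → Unique ys → Unique (map f ys)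
    map-unique []         []           = []
    map-unique (Py ∷ Pys) (y∉ys ∷ ys!) =
      Allₚ.map⁺ (All.zipWith (λ (Pz , y≢z) fy≡fz → y≢z (injective-on-P Py Pz fy≡fz)) (Pys , y∉ys))
      ∷ map-unique Pys ys!
    image⇒Q : ∀ {s} → s ∈ map f xs → Q (+ toℕ s)
    image⇒Q s∈ with ∈-map⁻ f s∈
    ... | r , r∈xs , refl = f∈Q r (to (∈xs⇔P r) r∈xs)
    Q⇒image : ∀ s → Q (+ toℕ s) → s ∈ map f xs
    Q⇒image s Qs with f-onto s Qs
    ... | r , Pr , refl = ∈-map⁺ f (from (∈xs⇔P r) Pr)

  Count-⋃ : (C : ℕ → ℤ → Set) (c : ℕ → ℕ) (d : ℕ) → (∀ i → Count p (C i) (c i)) →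
    (∀ {i j} → i < j → j < d → (r : Fin p) → C i (+ toℕ r) → ¬ C j (+ toℕ r)) →
    Count p (λ x → ∃ λ i → i < d × C i x) (sumTo d c)
  Count-⋃ C c zero    count-C disjoint = Count-∅ {P = λ x → ∃ λ i → i < 0 × C i x} λ { r (_ , () , _) }
  Count-⋃ C c (suc d) count-C disjoint =
    subst (Count p ⋃C) (sym (sumTo-suc d c))
      (Count-≐ {P = λ x → (∃ λ i → i < d × C i x) ⊎ C d x} {Q = ⋃C} split
        (Count-⊎ {P = λ x → ∃ λ i → i < d × C i x} {Q = C d}
          (Count-⋃ C c d count-C λ i<j j<d → disjoint i<j (ℕₚ.m<n⇒m<1+n j<d))
          (count-C d)
          λ { r (i , i<d , Cᵢr) → disjoint i<d ℕₚ.≤-refl r Cᵢr }))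
    where
    ⋃C : ℤ → Set
    ⋃C x = ∃ λ i → i < suc d × C i x
    split : (λ x → (∃ λ i → i < d × C i x) ⊎ C d x) ≐ ⋃C
    split r = mk⇔ [ (λ (i , i<d , Cᵢr) → i , ℕₚ.m<n⇒m<1+n i<d , Cᵢr) , (λ C_d → d , ℕₚ.≤-refl , C_d) ]′
                  λ (i , i<1+d , Cᵢr) → case (ℕₚ.m<1+n⇒m<n∨m≡n i<1+d) Cᵢr
      where
      case : ∀ {i} → i < d ⊎ i ≡ d → C i (+ toℕ r) → (∃ λ i → i < d × C i (+ toℕ r)) ⊎ C d (+ toℕ r)
      case (inj₁ i<d) Cᵢr  = inj₁ (_ , i<d , Cᵢr)
      case (inj₂ refl) Cᵢr = inj₂ Cᵢr

module Modular (p : ℕ) (p-prime : Prime p) where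

  open import Data.Integer using (_+_; _*_)

  open Counting p

  private
    instance
      p≢0 : ℕ.NonZero p
      p≢0 = prime⇒nonZero p-prime

    variable
      x y u v : ℤ

  1<p : 1 < p
  1<p = ℕ.nonTrivial⇒n>1 p {{prime⇒nonTrivial p-prime}}

  -- Defs' x ≡ y [mod p ] wrapped in a record, so that x and y can be inferred from a proof.
  infix 4 _≈_
  record _≈_ (x y : ℤ) : Set where
    constructor mk≈
    field p∣x-y : + p ∣ x - y
  open _≈_

  ≡[mod]⇒≈ : x ≡ y [mod p ] → x ≈ y
  ≡[mod]⇒≈ x≡y = mk≈ (∣ᵤ⇒∣ x≡y)

  ≈⇒≡[mod] : x ≈ y → x ≡ y [mod p ]
  ≈⇒≡[mod] x≈y = ∣⇒∣ᵤ (p∣x-y x≈y)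

  private
    ∣-≈ : ∀ {z} → z ≡ x - y → + p ∣ z → x ≈ y
    ∣-≈ refl p∣z = mk≈ p∣z

    ≈-byQuotient : ∀ q → x - y ≡ q * + p → x ≈ y
    ≈-byQuotient q eq = mk≈ (divides q eq)

    neg-minus : ∀ x y → - (x - y) ≡ y - x
    neg-minus = solve-∀
    minus-+ : ∀ x y u v → (x - y) + (u - v) ≡ (x + u) - (y + v)
    minus-+ = solve-∀
    minus-* : ∀ x y u v → (x - y) * u + y * (u - v) ≡ x * u - y * v
    minus-* = solve-∀
    minus-neg : ∀ x y → - (x - y) ≡ (- x) - (- y)
    minus-neg = solve-∀

  ≈-reflexive : x ≡ y → x ≈ y
  ≈-reflexive {x} refl = ≈-byQuotient (+ 0) (ℤₚ.+-inverseʳ x)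

  ≈-refl : x ≈ x
  ≈-refl = ≈-reflexive refl

  ≈-sym : x ≈ y → y ≈ x
  ≈-sym {x} {y} (mk≈ p∣x-y) = ∣-≈ (neg-minus x y) (∣m⇒∣-m p∣x-y)

  ≈-trans : x ≈ y → y ≈ u → x ≈ u
  ≈-trans {x} {y} {u} (mk≈ p∣x-y) (mk≈ p∣y-u) = ∣-≈ (ℤₚ.+-minus-telescope x y u) (∣m∣n⇒∣m+n p∣x-y p∣y-u)

  ≈-setoid : Setoid _ _
  ≈-setoid = record
    { Carrier       = ℤ
    ; _≈_           = _≈_
    ; isEquivalence = record { refl = ≈-refl ; sym = ≈-sym ; trans = ≈-trans }
    }

  module ≈-Reasoning = SetoidReasoning ≈-setoid

  +-cong : x ≈ y → u ≈ v → x + u ≈ y + v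
  +-cong {x} {y} {u} {v} (mk≈ p∣x-y) (mk≈ p∣u-v) = ∣-≈ (minus-+ x y u v) (∣m∣n⇒∣m+n p∣x-y p∣u-v)

  *-cong : x ≈ y → u ≈ v → x * u ≈ y * v
  *-cong {x} {y} {u} {v} (mk≈ p∣x-y) (mk≈ p∣u-v) =
    ∣-≈ (minus-* x y u v) (∣m∣n⇒∣m+n (∣m⇒∣m*n u p∣x-y) (∣n⇒∣m*n y p∣u-v))

  *-congˡ : ∀ u → x ≈ y → u * x ≈ u * y
  *-congˡ u = *-cong (≈-refl {u})

  *-congʳ : ∀ u → x ≈ y → x * u ≈ y * u
  *-congʳ u x≈y = *-cong x≈y (≈-refl {u})

  -‿cong : x ≈ y → - x ≈ - y
  -‿cong {x} {y} (mk≈ p∣x-y) = ∣-≈ (minus-neg x y) (∣m⇒∣-m p∣x-y)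

  ^-cong : ∀ n → x ≈ y → x ^ n ≈ y ^ n
  ^-cong zero    x≈y = ≈-refl
  ^-cong (suc n) x≈y = *-cong x≈y (^-cong n x≈y)

  ≈0⇔∣ : x ≈ + 0 ⇔ p ℕ∣.∣ ∣ x ∣
  ≈0⇔∣ {x} = mk⇔ (λ x≈0 → subst (λ z → p ℕ∣.∣ ∣ z ∣) (ℤₚ.+-identityʳ x) (∣⇒∣ᵤ (p∣x-y x≈0)))
                 (λ p∣x → mk≈ (∣ᵤ⇒∣ (subst (λ z → p ℕ∣.∣ ∣ z ∣) (sym (ℤₚ.+-identityʳ x)) p∣x)))

  x-y≈0⇒x≈y : x - y ≈ + 0 → x ≈ y
  x-y≈0⇒x≈y {x} {y} x-y≈0 = ∣-≈ (ℤₚ.+-identityʳ (x - y)) (p∣x-y x-y≈0)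

  Nonzero : ℤ → Set
  Nonzero x = ¬ x ≈ + 0

  Nonzero-resp : x ≈ y → Nonzero x → Nonzero y
  Nonzero-resp x≈y x≉0 y≈0 = x≉0 (≈-trans x≈y y≈0)

  *≈0⇒ : x * y ≈ + 0 → x ≈ + 0 ⊎ y ≈ + 0
  *≈0⇒ {x} {y} xy≈0 =
    Sum.map (from ≈0⇔∣) (from ≈0⇔∣) (euclidsLemma ∣ x ∣ ∣ y ∣ p-prime
      (subst (p ℕ∣.∣_) (ℤₚ.abs-* x y) (to ≈0⇔∣ xy≈0)))

  *-nonzero : Nonzero x → Nonzero y → Nonzero (x * y)
  *-nonzero x≉0 y≉0 = [ x≉0 , y≉0 ]′ ∘ *≈0⇒

  *-nonzero⁻ˡ : Nonzero (x * y) → Nonzero x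
  *-nonzero⁻ˡ {x} {y} xy≉0 x≈0 = xy≉0 (≈-trans (*-congʳ y x≈0) (≈-reflexive (ℤₚ.*-zeroˡ y)))

  *-cancelˡ : Nonzero u → u * x ≈ u * y → x ≈ y
  *-cancelˡ {u} {x} {y} u≉0 ux≈uy = [ ⊥-elim ∘ u≉0 , x-y≈0⇒x≈y ]′ (*≈0⇒ u[x-y]≈0)
    where
    factor : ∀ u x y → u * (x - y) - + 0 ≡ u * x - u * y
    factor = solve-∀
    u[x-y]≈0 : u * (x - y) ≈ + 0
    u[x-y]≈0 = ∣-≈ (sym (factor u x y)) (p∣x-y ux≈uy)

  x²≈y²⇒x≈±y : x * x ≈ y * y → x ≈ y ⊎ x ≈ - y
  x²≈y²⇒x≈±y {x} {y} x²≈y² =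
    Sum.map x-y≈0⇒x≈y (x-y≈0⇒x≈y ∘ ≈-trans (≈-reflexive (plus-as-minus x y))) (*≈0⇒ (begin
    (x - y) * (x + y)  ≡⟨ difference-of-squares x y ⟩
    x * x - y * y      ≈⟨ +-cong x²≈y² (≈-refl { - (y * y)}) ⟩
    y * y - y * y      ≡⟨ ℤₚ.+-inverseʳ (y * y) ⟩
    + 0                ∎))
    where
    open ≈-Reasoning
    difference-of-squares : ∀ x y → (x - y) * (x + y) ≡ x * x - y * y
    difference-of-squares = solve-∀
    plus-as-minus : ∀ x y → x - - y ≡ x + y
    plus-as-minus = solve-∀

  ≈0⇒x*x≈x : x ≈ + 0 → x * x ≈ x
  ≈0⇒x*x≈x x≈0 = ≈-trans (*-cong x≈0 x≈0) (≈-sym x≈0)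

  small-nonzero : ∀ {a} → 0 < a → a < p → Nonzero (+ a)
  small-nonzero 0<a a<p a≈0 = ℕₚ.<⇒≱ a<p (ℕ∣.∣⇒≤ {{ℕ.>-nonZero 0<a}} (to ≈0⇔∣ a≈0))

  1-nonzero : Nonzero (+ 1)
  1-nonzero = small-nonzero ℕₚ.0<1+n 1<p

  ^-nonzero : ∀ n → Nonzero x → Nonzero (x ^ n)
  ^-nonzero zero    _   = 1-nonzero
  ^-nonzero (suc n) x≉0 = *-nonzero x≉0 (^-nonzero n x≉0)

  <p-≈-injective : ∀ {a b} → a < p → b < p → + a ≈ + b → a ≡ b
  <p-≈-injective {a} {b} a<p b<p a≈b =
    ℤₚ.+-injective (ℤₚ.i-j≡0⇒i≡j (+ a) (+ b) (ℤₚ.∣i∣≡0⇒i≡0 ∣a-b∣≡0))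
    where
    ∣a-b∣<p : ∣ + a - + b ∣ < p
    ∣a-b∣<p = subst (_< p) (cong ∣_∣ (sym (ℤₚ.m-n≡m⊖n a b)))
                (ℕₚ.≤-<-trans (ℤₚ.∣m⊝n∣≤m⊔n a b) (ℕₚ.⊔-pres-<m a<p b<p))
    ∣a-b∣≡0 : ∣ + a - + b ∣ ≡ 0
    ∣a-b∣≡0 = trans (sym (ℕDivMod.m<n⇒m%n≡m ∣a-b∣<p)) (ℕ∣.n∣m⇒m%n≡0 _ p (∣⇒∣ᵤ (p∣x-y a≈b)))

  toℕ-≈-injective : ∀ {r s : Fin p} → + toℕ r ≈ + toℕ s → r ≡ s
  toℕ-≈-injective {r} {s} r≈s = Finₚ.toℕ-injective (<p-≈-injective (Finₚ.toℕ<n r) (Finₚ.toℕ<n s) r≈s)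

  toℕ-≈0 : ∀ (r : Fin p) → + toℕ r ≈ + 0 → toℕ r ≡ 0
  toℕ-≈0 r = <p-≈-injective (Finₚ.toℕ<n r) (ℕₚ.<-trans ℕₚ.0<1+n 1<p)

  residue : ℤ → Fin p
  residue x = Fin.fromℕ< (n%ℕd<d x p)

  residue-≈ : ∀ x → + toℕ (residue x) ≈ x
  residue-≈ x rewrite Finₚ.toℕ-fromℕ< (n%ℕd<d x p) = ∣-≈ eq (∣m⇒∣-m (∣n⇒∣m*n (x /ℕ p) ∣-refl))
    where
    open ≡-Reasoning
    cancel : ∀ r q P → - (q * P) ≡ r - (r + q * P)
    cancel = solve-∀
    eq : - (x /ℕ p * + p) ≡ + (x %ℕ p) - x
    eq = begin
      - (x /ℕ p * + p)                            ≡⟨ cancel (+ (x %ℕ p)) (x /ℕ p) (+ p) ⟩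
      + (x %ℕ p) - (+ (x %ℕ p) + x /ℕ p * + p)    ≡⟨ cong (λ z → + (x %ℕ p) - z) (sym (a≡a%ℕn+[a/ℕn]*n x p)) ⟩
      + (x %ℕ p) - x                              ∎

  residue-cong : x ≈ y → residue x ≡ residue y
  residue-cong {x} {y} x≈y = toℕ-≈-injective (≈-trans (residue-≈ x) (≈-trans x≈y (≈-sym (residue-≈ y))))

  residue-toℕ : ∀ r → residue (+ toℕ r) ≡ r
  residue-toℕ r = toℕ-≈-injective (residue-≈ (+ toℕ r))

  -- Kept opaque, like the witnesses in Cosets: unfolding them during unification is prohibitively slow.
  opaque
    inverse : Nonzero x → ∃ λ y → x * y ≈ + 1
    inverse {x} x≉0 = let y , ny≈1 = inverse-of-n in y , ≈-trans (*-congʳ y (≈-sym (residue-≈ x))) ny≈1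
      where
      n : ℕ
      n = toℕ (residue x)
      n≢0 : ℕ.NonZero n
      n≢0 = ℕ.≢-nonZero (λ n≡0 → x≉0 (≈-trans (≈-sym (residue-≈ x)) (≈-reflexive (cong +_ n≡0))))
      open ≡-Reasoning
      inverse-of-n : ∃ λ y → + n * y ≈ + 1
      inverse-of-n with coprime-Bézout (prime⇒coprime p-prime {{n≢0}} (Finₚ.toℕ<n (residue x)))
      ... | Bézout.+- a b 1+bn≡ap = - + b , ≈-byQuotient (- + a) (begin
        + n * - + b - + 1        ≡⟨ rearrange (+ n) (+ b) ⟩
        - (+ 1 + + b * + n)      ≡⟨ cong (λ z → - (+ 1 + z)) (sym (ℤₚ.pos-* b n)) ⟩
        - + (1 ℕ.+ b ℕ.* n)      ≡⟨ cong (-_ ∘ +_) 1+bn≡ap ⟩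
        - + (a ℕ.* p)            ≡⟨ cong -_ (ℤₚ.pos-* a p) ⟩
        - (+ a * + p)            ≡⟨ ℤₚ.neg-distribˡ-* (+ a) (+ p) ⟩
        - + a * + p              ∎)
        where
        rearrange : ∀ n b → n * - b - + 1 ≡ - (+ 1 + b * n)
        rearrange = solve-∀
      ... | Bézout.-+ a b 1+ap≡bn = + b , ≈-byQuotient (+ a) (begin
        + n * + b - + 1          ≡⟨ cong (_- + 1) (ℤₚ.*-comm (+ n) (+ b)) ⟩
        + b * + n - + 1          ≡⟨ cong (_- + 1) (sym (ℤₚ.pos-* b n)) ⟩
        + (b ℕ.* n) - + 1        ≡⟨ cong (λ z → + z - + 1) (sym 1+ap≡bn) ⟩
        + (1 ℕ.+ a ℕ.* p) - + 1  ≡⟨ cancel (+ (a ℕ.* p)) ⟩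
        + (a ℕ.* p)              ≡⟨ ℤₚ.pos-* a p ⟩
        + a * + p                ∎)
        where
        cancel : ∀ z → + 1 + z - + 1 ≡ z
        cancel = solve-∀

  ≈0⇒square : x ≈ + 0 → IsSquare p x
  ≈0⇒square x≈0 = residue (+ 0) , ≈⇒≡[mod] (≈-trans x≈0 (≈-sym (≈-trans (≈0⇒x*x≈x r≈0) r≈0)))
    where
    r≈0 : + toℕ (residue (+ 0)) ≈ + 0
    r≈0 = residue-≈ (+ 0)

  Count-≈0 : ∀ {Q} → Q Respects _≈_ → Q (+ 0) → Count p (λ x → x ≈ + 0 × Q x) 1
  Count-≈0 Q-resp Q0 =
    residue (+ 0) ∷ [] , [] ∷ [] ,
    (λ r → mk⇔ (λ { (here refl) → residue-≈ (+ 0) , Q-resp (≈-sym (residue-≈ (+ 0))) Q0 })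
               (λ (r≈0 , _) → here (toℕ-≈-injective (≈-trans r≈0 (≈-sym (residue-≈ (+ 0))))))) ,
    refl

  Count-≉0 : ∀ {Q} → Q Respects _≈_ → ¬ Q (+ 0) → Count p (λ x → x ≈ + 0 × Q x) 0
  Count-≉0 {Q} Q-resp ¬Q0 = Count-∅ {P = λ x → x ≈ + 0 × Q x} λ r (r≈0 , Qr) → ¬Q0 (Q-resp r≈0 Qr)

  ≈0? : (r : Fin p) → Dec (+ toℕ r ≈ + 0)
  ≈0? r with toℕ r ℕ.≟ 0
  ... | yes r≡0 = yes (≈-reflexive (cong +_ r≡0))
  ... | no  r≢0 = no (small-nonzero (ℕₚ.n≢0⇒n>0 r≢0) (Finₚ.toℕ<n r))

  Count-nonzero : Count p Nonzero (p ∸ 1)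
  Count-nonzero with m , count ← Count-filter {P = λ _ → ⊤} {Q = Nonzero} Count-all (¬? ∘ ≈0?) =
    subst (Count p Nonzero) (cong (_∸ 1) 1+m≡p)
      (Count-≐ {P = λ x → ⊤ × Nonzero x} {Q = Nonzero} (λ _ → mk⇔ proj₂ (tt ,_)) count)
    where
    zero-or-nonzero : (λ _ → ⊤) ≐ (λ x → (x ≈ + 0 × ⊤) ⊎ (⊤ × Nonzero x))
    zero-or-nonzero r with ≈0? r
    ... | yes r≈0 = mk⇔ (λ _ → inj₁ (r≈0 , tt)) _
    ... | no  r≉0 = mk⇔ (λ _ → inj₂ (tt , r≉0)) _
    1+m≡p : suc m ≡ p
    1+m≡p = Count-unique {P = λ _ → ⊤}
      (Count-≐ {P = λ x → (x ≈ + 0 × ⊤) ⊎ (⊤ × Nonzero x)} {Q = λ _ → ⊤} (⇔.sym ∘ zero-or-nonzero)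
      (Count-⊎ {P = λ x → x ≈ + 0 × ⊤} {Q = λ x → ⊤ × Nonzero x}
               (Count-≈0 {Q = λ _ → ⊤} _ tt) count λ r (r≈0 , _) (_ , r≉0) → r≉0 r≈0)) Count-all

  InShift1⇔ : ∀ {S x} → S Respects _≈_ → InShift1 p S x ⇔ S (x - + 1)
  InShift1⇔ {x = x} S-resp = mk⇔
    (λ (s , Ss , x≡1+s) → S-resp (≈-trans (≈-reflexive (sym (shift-back s)))
                                  (+-cong (≈-sym (≡[mod]⇒≈ {x} {+ 1 + s} x≡1+s)) (≈-refl { - + 1}))) Ss)
    (λ S[x-1] → x - + 1 , S[x-1] , ≈⇒≡[mod] (≈-reflexive (shift-forth x)))
    where
    shift-back : ∀ s → + 1 + s - + 1 ≡ s
    shift-back = solve-∀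
    shift-forth : ∀ x → x ≡ + 1 + (x - + 1)
    shift-forth = solve-∀

  record IsUnitSubmonoid (H : ℤ → Set) : Set where
    field
      resp    : H Respects _≈_
      one     : H (+ 1)
      mul     : ∀ {x y} → H x → H y → H (x * y)
      nonzero : ∀ {x} → H x → Nonzero x

module Cosets (p : ℕ) (p-prime : Prime p) (g : ℤ) (g-primitive : PrimitiveRoot p g)
              (H : ℤ → Set) (H-submonoid : Modular.IsUnitSubmonoid p p-prime H)
              (nH : ℕ) (count-H : Count p H nH) where

  open import Data.Integer using (_+_; _*_)

  open Counting p
  open Modular p p-prime
  open IsUnitSubmonoid H-submonoid renaming (resp to H-resp; one to H-one; mul to H-mul; nonzero to H-nonzero)

  private
    variable
      x y u : ℤ

  g-nonzero : Nonzero g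
  g-nonzero g≈0 = proj₁ g-primitive (≈⇒≡[mod] g≈0)

  power-of-g : Nonzero x → ∃ λ n → x ≈ g ^ n
  power-of-g {x} x≉0 = Product.map₂ ≡[mod]⇒≈ (proj₂ g-primitive x (x≉0 ∘ ≡[mod]⇒≈))

  private opaque
    g^[1+n]≈1 : ∃ λ n → g ^ suc n ≈ + 1
    g^[1+n]≈1 with y , gy≈1 ← inverse g-nonzero =
      Product.map₂ (λ y≈gⁿ → ≈-trans (*-congˡ g (≈-sym y≈gⁿ)) gy≈1) (power-of-g y≉0)
      where
      y≉0 : Nonzero y
      y≉0 y≈0 = 1-nonzero (≈-trans (≈-sym gy≈1) (≈-trans (*-congˡ g y≈0) (≈-reflexive (ℤₚ.*-zeroʳ g))))

  period : ℕ
  period = suc (proj₁ g^[1+n]≈1)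

  ^-period : Nonzero x → x ^ period ≈ + 1
  ^-period {x} x≉0 with n , x≈gⁿ ← power-of-g x≉0 = begin
    x ^ period          ≈⟨ ^-cong period x≈gⁿ ⟩
    (g ^ n) ^ period    ≡⟨ ^-comm g n period ⟩
    (g ^ period) ^ n    ≈⟨ ^-cong n (proj₂ g^[1+n]≈1) ⟩
    (+ 1) ^ n           ≡⟨ ℤₚ.^-zeroˡ n ⟩
    + 1                 ∎
    where
    open ≈-Reasoning
    ^-comm : ∀ z m n → (z ^ m) ^ n ≡ (z ^ n) ^ m
    ^-comm z m n = trans (ℤₚ.^-*-assoc z m n) (trans (cong (z ^_) (ℕₚ.*-comm m n)) (sym (ℤₚ.^-*-assoc z n m)))

  H-^ : ∀ n → H u → H (u ^ n)
  H-^ zero    Hu = H-one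
  H-^ (suc n) Hu = H-mul Hu (H-^ n Hu)

  H-inverse : H u → ∃ λ v → H v × u * v ≈ + 1
  H-inverse Hu = _ , H-^ (proj₁ g^[1+n]≈1) Hu , ^-period (H-nonzero Hu)

  H? : ∀ x → Dec (H x)
  H? x = map′ (H-resp (residue-≈ x)) (H-resp (≈-sym (residue-≈ x))) (Count-dec {P = H} count-H (residue x))

  private opaque
    smallest : ∃ λ k → H (g ^ suc k) × (∀ {j} → j < k → ¬ H (g ^ suc j))
    smallest = ∃-smallest (λ k → H? (g ^ suc k)) {proj₁ g^[1+n]≈1} (H-resp (≈-sym (proj₂ g^[1+n]≈1)) H-one)

  -- ℓ in the paper: by index*nH≡p∸1 below, this is the index of H in ℤₚ^×.
  index : ℕ
  index = suc (proj₁ smallest)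

  g^index∈H : H (g ^ index)
  g^index∈H = proj₁ (proj₂ smallest)

  index-minimal : ∀ {t} → 0 < t → t < index → ¬ H (g ^ t)
  index-minimal {suc t} _ (s≤s t<k) = proj₂ (proj₂ smallest) t<k

  Coset : ℤ → ℤ → Set
  Coset (+ n)    x = ∃ λ y → H y × x ≈ g ^ n * y
  Coset -[1+ n ] x = ∃ λ y → H y × y ≈ g ^ suc n * x

  Coset-resp : ∀ j → Coset j Respects _≈_
  Coset-resp (+ n)    x≈x′ (y , Hy , x≈gⁿy) = y , Hy , ≈-trans (≈-sym x≈x′) x≈gⁿy
  Coset-resp -[1+ n ] x≈x′ (y , Hy , y≈gⁿx) = y , Hy , ≈-trans y≈gⁿx (*-congˡ (g ^ suc n) x≈x′)

  Coset-≈ : ∀ j → x ≈ y → Coset j x ⇔ Coset j y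
  Coset-≈ j x≈y = mk⇔ (Coset-resp j x≈y) (Coset-resp j (≈-sym x≈y))

  Coset-≡ : ∀ {m n} → m ≡ n → Coset (+ m) x ⇔ Coset (+ n) x
  Coset-≡ refl = ⇔.refl

  Coset-nonzero : ∀ n → Coset (+ n) x → Nonzero x
  Coset-nonzero n (y , Hy , x≈gⁿy) = Nonzero-resp (≈-sym x≈gⁿy) (*-nonzero (^-nonzero n g-nonzero) (H-nonzero Hy))

  Coset₀⇔H : Coset (+ 0) x ⇔ H x
  Coset₀⇔H {x} = mk⇔ (λ (y , Hy , x≈1y) → H-resp (≈-sym (≈-trans x≈1y (≈-reflexive (ℤₚ.*-identityˡ y)))) Hy)
                     (λ Hx → x , Hx , ≈-reflexive (sym (ℤₚ.*-identityˡ x)))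

  Coset⁻⇔H : ∀ s → Coset -[1+ s ] x ⇔ H (g ^ suc s * x)
  Coset⁻⇔H s = mk⇔ (λ (y , Hy , y≈gˢx) → H-resp y≈gˢx Hy) (λ H[gˢx] → _ , H[gˢx] , ≈-refl)

  gⁿ∈gⁿH : ∀ n → Coset (+ n) (g ^ n)
  gⁿ∈gⁿH n = + 1 , H-one , ≈-reflexive (sym (ℤₚ.*-identityʳ (g ^ n)))

  Coset-mul : ∀ {a} i t → Coset (+ i) a → Coset (+ t) x ⇔ Coset (+ (i ℕ.+ t)) (a * x)
  Coset-mul {x} {a} i t (u , Hu , a≈gⁱu) = mk⇔ forward backward
    where
    open ≈-Reasoning
    forward : Coset (+ t) x → Coset (+ (i ℕ.+ t)) (a * x)
    forward (y , Hy , x≈gᵗy) = u * y , H-mul Hu Hy , (begin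
      a * x                     ≈⟨ *-cong a≈gⁱu x≈gᵗy ⟩
      g ^ i * u * (g ^ t * y)   ≡⟨ interchange (g ^ i) u (g ^ t) y ⟩
      g ^ i * g ^ t * (u * y)   ≡⟨ cong (_* (u * y)) (sym (ℤₚ.^-distribˡ-+-* g i t)) ⟩
      g ^ (i ℕ.+ t) * (u * y)   ∎)
      where
      interchange : ∀ a b c d → a * b * (c * d) ≡ a * c * (b * d)
      interchange = solve-∀
    backward : Coset (+ (i ℕ.+ t)) (a * x) → Coset (+ t) x
    backward (w , Hw , ax≈gⁱ⁺ᵗw) with v , Hv , uv≈1 ← H-inverse Hu = w * v , H-mul Hw Hv , (begin
      x               ≡⟨ sym (ℤₚ.*-identityʳ x) ⟩
      x * + 1         ≈⟨ *-congˡ x (≈-sym uv≈1) ⟩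
      x * (u * v)     ≡⟨ rotate x u v ⟩
      u * x * v       ≈⟨ *-congʳ v ux≈gᵗw ⟩
      g ^ t * w * v   ≡⟨ ℤₚ.*-assoc (g ^ t) w v ⟩
      g ^ t * (w * v) ∎)
      where
      rotate : ∀ x u v → x * (u * v) ≡ u * x * v
      rotate = solve-∀
      ux≈gᵗw : u * x ≈ g ^ t * w
      ux≈gᵗw = *-cancelˡ (^-nonzero i g-nonzero) (begin
        g ^ i * (u * x)       ≡⟨ sym (ℤₚ.*-assoc (g ^ i) u x) ⟩
        g ^ i * u * x         ≈⟨ *-congʳ x (≈-sym a≈gⁱu) ⟩
        a * x                 ≈⟨ ax≈gⁱ⁺ᵗw ⟩
        g ^ (i ℕ.+ t) * w     ≡⟨ cong (_* w) (ℤₚ.^-distribˡ-+-* g i t) ⟩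
        g ^ i * g ^ t * w     ≡⟨ ℤₚ.*-assoc (g ^ i) (g ^ t) w ⟩
        g ^ i * (g ^ t * w)   ∎)

  Coset-*H : ∀ t → H u → Coset (+ t) x ⇔ Coset (+ t) (u * x)
  Coset-*H t Hu = Coset-mul 0 t (from Coset₀⇔H Hu)

  1∈Coset⇒gᵗ∈H : ∀ t → Coset (+ t) (+ 1) → H (g ^ t)
  1∈Coset⇒gᵗ∈H t (y , Hy , 1≈gᵗy) with v , Hv , yv≈1 ← H-inverse Hy = H-resp (≈-sym gᵗ≈v) Hv
    where
    open ≈-Reasoning
    gᵗ≈v : g ^ t ≈ v
    gᵗ≈v = begin
      g ^ t             ≡⟨ sym (ℤₚ.*-identityʳ (g ^ t)) ⟩
      g ^ t * + 1       ≈⟨ *-congˡ (g ^ t) (≈-sym yv≈1) ⟩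
      g ^ t * (y * v)   ≡⟨ sym (ℤₚ.*-assoc (g ^ t) y v) ⟩
      g ^ t * y * v     ≈⟨ *-congʳ v (≈-sym 1≈gᵗy) ⟩
      + 1 * v           ≡⟨ ℤₚ.*-identityˡ v ⟩
      v                 ∎

  Coset-unique : ∀ {i j} → i < j → j < index → Coset (+ i) x → ¬ Coset (+ j) x
  Coset-unique {x} {i} {j} i<j j<index x∈gⁱH x∈gʲH =
    index-minimal (ℕₚ.m<n⇒0<n∸m i<j) (ℕₚ.≤-<-trans (ℕₚ.m∸n≤m j i) j<index)
      (1∈Coset⇒gᵗ∈H t (from (Coset-mul i t x∈gⁱH) x·1∈gⁱ⁺ᵗH))
    where
    t : ℕ
    t = j ∸ i
    x·1∈gⁱ⁺ᵗH : Coset (+ (i ℕ.+ t)) (x * + 1)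
    x·1∈gⁱ⁺ᵗH = subst (λ n → Coset (+ n) (x * + 1)) (sym (ℕₚ.m+[n∸m]≡n (ℕₚ.<⇒≤ i<j)))
                  (Coset-resp (+ j) (≈-reflexive (sym (ℤₚ.*-identityʳ x))) x∈gʲH)

  Coset-exists : Nonzero x → ∃ λ i → i < index × Coset (+ i) x
  Coset-exists {x} x≉0 with n , x≈gⁿ ← power-of-g x≉0 =
    n % index , ℕDivMod.m%n<n n index , (g ^ index) ^ (n / index) , H-^ (n / index) g^index∈H , (begin
      x                                        ≈⟨ x≈gⁿ ⟩
      g ^ n                                    ≡⟨ cong (g ^_) (ℕDivMod.m≡m%n+[m/n]*n n index) ⟩
      g ^ (n % index ℕ.+ n / index ℕ.* index)  ≡⟨ ℤₚ.^-distribˡ-+-* g (n % index) _ ⟩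
      g ^ (n % index) * g ^ (n / index ℕ.* index)
        ≡⟨ cong (λ m → g ^ (n % index) * g ^ m) (ℕₚ.*-comm (n / index) index) ⟩
      g ^ (n % index) * g ^ (index ℕ.* (n / index))
        ≡⟨ cong (g ^ (n % index) *_) (sym (ℤₚ.^-*-assoc g index (n / index))) ⟩
      g ^ (n % index) * (g ^ index) ^ (n / index) ∎)
    where
    open ℕDivMod using (_%_; _/_)
    open ≈-Reasoning

  Coset-count : ∀ i → Count p (Coset (+ i)) nH
  Coset-count i = Count-image {P = H} {Q = Coset (+ i)} count-H f injective f∈gⁱH onto
    where
    open ≈-Reasoning
    f : Fin p → Fin p
    f r = residue (g ^ i * + toℕ r)
    f-≈ : ∀ r → + toℕ (f r) ≈ g ^ i * + toℕ r
    f-≈ r = residue-≈ (g ^ i * + toℕ r)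
    injective : ∀ {r s} → H (+ toℕ r) → H (+ toℕ s) → f r ≡ f s → r ≡ s
    injective {r} {s} _ _ fr≡fs = toℕ-≈-injective (*-cancelˡ (^-nonzero i g-nonzero) (begin
      g ^ i * + toℕ r   ≈⟨ ≈-sym (f-≈ r) ⟩
      + toℕ (f r)       ≡⟨ cong (+_ ∘ toℕ) fr≡fs ⟩
      + toℕ (f s)       ≈⟨ f-≈ s ⟩
      g ^ i * + toℕ s   ∎))
    f∈gⁱH : ∀ r → H (+ toℕ r) → Coset (+ i) (+ toℕ (f r))
    f∈gⁱH r Hr = + toℕ r , Hr , f-≈ r
    onto : ∀ s → Coset (+ i) (+ toℕ s) → ∃ λ r → H (+ toℕ r) × f r ≡ s
    onto s (y , Hy , s≈gⁱy) =
      residue y , H-resp (≈-sym (residue-≈ y)) Hy ,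
      trans (residue-cong (≈-trans (*-congˡ (g ^ i) (residue-≈ y)) (≈-sym s≈gⁱy))) (residue-toℕ s)

  index*nH≡p∸1 : index ℕ.* nH ≡ p ∸ 1
  index*nH≡p∸1 = trans (sym (sumTo-const index nH))
    (Count-unique {P = Nonzero}
      (Count-≐ {P = λ x → ∃ λ i → i < index × Coset (+ i) x} {Q = Nonzero} in-some-coset⇔nonzero
        (Count-⋃ (Coset ∘ +_) (λ _ → nH) index Coset-count λ i<j j<index _ → Coset-unique i<j j<index))
      Count-nonzero)
    where
    in-some-coset⇔nonzero : (λ x → ∃ λ i → i < index × Coset (+ i) x) ≐ Nonzero
    in-some-coset⇔nonzero _ = mk⇔ (λ (i , _ , x∈gⁱH) → Coset-nonzero i x∈gⁱH) Coset-exists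

  index-unique : ∀ ℓ → ℓ ℕ.* nH ≡ p ∸ 1 → index ≡ ℓ
  index-unique ℓ ℓ*nH≡p∸1 = ℕₚ.*-cancelʳ-≡ index ℓ nH {{nH≢0}} (trans index*nH≡p∸1 (sym ℓ*nH≡p∸1))
    where
    nH≢0 : ℕ.NonZero nH
    nH≢0 = ℕ.≢-nonZero λ nH≡0 →
      ℕₚ.m>n⇒m∸n≢0 1<p (trans (sym ℓ*nH≡p∸1) (trans (cong (ℓ ℕ.*_) nH≡0) (ℕₚ.*-zeroʳ ℓ)))

  Coset-mul⁻ : ∀ {a} k s → Coset (+ (suc k ℕ.+ s)) a → Coset -[1+ s ] x ⇔ Coset (+ k) (a * x)
  Coset-mul⁻ {x} {a} k s a∈gᵏ⁺ˢ⁺¹H = begin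
    Coset -[1+ s ] x                                 ≈⟨ Coset⁻⇔H s ⟩
    H (g ^ suc s * x)                                ≈⟨ ⇔.sym Coset₀⇔H ⟩
    Coset (+ 0) (g ^ suc s * x)                      ≈⟨ Coset-mul (suc k ℕ.+ s) 0 a∈gᵏ⁺ˢ⁺¹H ⟩
    Coset (+ (suc k ℕ.+ s ℕ.+ 0)) (a * (g ^ suc s * x)) ≈⟨ Coset-≡ index-eq ⟩
    Coset (+ (suc s ℕ.+ k)) (a * (g ^ suc s * x))   ≈⟨ Coset-≈ (+ (suc s ℕ.+ k)) (≈-reflexive (swap a (g ^ suc s) x)) ⟩
    Coset (+ (suc s ℕ.+ k)) (g ^ suc s * (a * x))   ≈⟨ ⇔.sym (Coset-mul (suc s) k (gⁿ∈gⁿH (suc s))) ⟩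
    Coset (+ k) (a * x)                              ∎
    where
    open ⇔-Reasoning
    swap : ∀ a b x → a * (b * x) ≡ b * (a * x)
    swap = solve-∀
    index-eq : suc k ℕ.+ s ℕ.+ 0 ≡ suc s ℕ.+ k
    index-eq = trans (ℕₚ.+-identityʳ (suc k ℕ.+ s)) (cong suc (ℕₚ.+-comm k s))

  Coset-shift : ∀ {a} i k → Coset (+ i) a → Coset (+ k - + i) x ⇔ Coset (+ k) (a * x)
  Coset-shift {x} {a} i k a∈gⁱH with i ℕ.≤? k
  ... | yes i≤k with t , refl ← ℕₚ.m≤n⇒∃[o]m+o≡n i≤k =
    subst (λ j → Coset j x ⇔ Coset (+ (i ℕ.+ t)) (a * x)) (sym (cancelˡ (+ i) (+ t))) (Coset-mul i t a∈gⁱH)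
    where
    cancelˡ : ∀ i t → i + t - i ≡ t
    cancelˡ = solve-∀
  ... | no  i≰k with s , refl ← ℕₚ.m≤n⇒∃[o]m+o≡n (ℕₚ.≰⇒> i≰k) =
    subst (λ j → Coset j x ⇔ Coset (+ k) (a * x)) (sym (k-[1+k+s] (+ k) (+ s))) (Coset-mul⁻ k s a∈gⁱH)
    where
    k-[1+k+s] : ∀ k s → k - (+ 1 + k + s) ≡ - (+ 1 + s)
    k-[1+k+s] = solve-∀

module OddPrime (p : ℕ) (p-prime : Prime p) (p≢2 : p ≢ 2) where

  open import Data.Integer using (_+_; _*_)

  open Counting p
  open Modular p p-prime

  2-nonzero : Nonzero (+ 2)
  2-nonzero = small-nonzero ℕₚ.0<1+n (ℕₚ.≤∧≢⇒< 1<p (p≢2 ∘ sym))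

  negate : Fin p → Fin p
  negate r = residue (- + toℕ r)

  negate-≈ : ∀ r → + toℕ (negate r) ≈ - + toℕ r
  negate-≈ r = residue-≈ (- + toℕ r)

  negate-involutive : ∀ r → negate (negate r) ≡ r
  negate-involutive r = toℕ-≈-injective (begin
    + toℕ (negate (negate r))  ≈⟨ negate-≈ (negate r) ⟩
    - + toℕ (negate r)         ≈⟨ -‿cong (negate-≈ r) ⟩
    - - + toℕ r                ≡⟨ ℤₚ.neg-involutive _ ⟩
    + toℕ r                    ∎)
    where open ≈-Reasoning

  -- Of two nonzero residues ±r exactly one is Lower: the one with the smaller representative.
  Lower Upper : ℤ → Set
  Lower x = ∣ x ∣ < toℕ (residue (- x))
  Upper x = toℕ (residue (- x)) < ∣ x ∣

  Lower⇒nonzero : ∀ r → Lower (+ toℕ r) → Nonzero (+ toℕ r)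
  Lower⇒nonzero r r<-r r≈0 = ℕₚ.n≮0 (subst (toℕ r <_) (toℕ-≈0 (negate r) (≈-trans (negate-≈ r) (-‿cong r≈0))) r<-r)

  Upper⇒nonzero : ∀ r → Upper (+ toℕ r) → Nonzero (+ toℕ r)
  Upper⇒nonzero r -r<r r≈0 = ℕₚ.n≮0 (subst (toℕ (negate r) <_) (toℕ-≈0 r r≈0) -r<r)

  trichotomy : ∀ r → + toℕ r ≈ + 0 ⊎ Lower (+ toℕ r) ⊎ Upper (+ toℕ r)
  trichotomy r with ℕₚ.<-cmp (toℕ r) (toℕ (negate r))
  ... | tri< r<-r _ _ = inj₂ (inj₁ r<-r)
  ... | tri> _ _ -r<r = inj₂ (inj₂ -r<r)
  ... | tri≈ _ r≡-r _ = inj₁ ([ (λ 2≈0 → ⊥-elim (2-nonzero 2≈0)) , id ]′ (*≈0⇒ 2r≈0))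
    where
    r≈-r : + toℕ r ≈ - + toℕ r
    r≈-r = ≈-trans (≈-reflexive (cong +_ r≡-r)) (negate-≈ r)
    double : ∀ x → + 2 * x ≡ x + x
    double = solve-∀
    2r≈0 : + 2 * + toℕ r ≈ + 0
    2r≈0 = ≈-trans (≈-reflexive (double (+ toℕ r)))
             (≈-trans (+-cong r≈-r (≈-refl {+ toℕ r})) (≈-reflexive (ℤₚ.+-inverseˡ (+ toℕ r))))

  Count-Lower⇒Upper : ∀ {R n} → R Respects _≈_ → (∀ {x} → R x → R (- x)) →
    Count p (λ x → R x × Lower x) n → Count p (λ x → R x × Upper x) n
  Count-Lower⇒Upper {R} R-resp R-neg count =
    Count-image {P = λ x → R x × Lower x} {Q = λ x → R x × Upper x} count negate
      (λ {r} {s} _ _ -r≡-s → trans (sym (negate-involutive r)) (trans (cong negate -r≡-s) (negate-involutive s)))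
      (λ r (Rr , r<-r) → R-resp (≈-sym (negate-≈ r)) (R-neg Rr) ,
                         subst (λ s → toℕ s < toℕ (negate r)) (sym (negate-involutive r)) r<-r)
      (λ s (Rs , -s<s) → negate s ,
         (R-resp (≈-sym (negate-≈ s)) (R-neg Rs) ,
          subst (λ r → toℕ (negate s) < toℕ r) (sym (negate-involutive s)) -s<s) ,
         negate-involutive s)

  ≈-negate⇒≡ : ∀ {r s} → + toℕ r ≈ - + toℕ s → negate s ≡ r
  ≈-negate⇒≡ r≈-s = toℕ-≈-injective (≈-trans (negate-≈ _) (≈-sym r≈-s))

  negate-square : ∀ r → + toℕ (negate r) * + toℕ (negate r) ≈ + toℕ r * + toℕ r
  negate-square r = ≈-trans (*-cong (negate-≈ r) (negate-≈ r)) (≈-reflexive (square-neg (+ toℕ r)))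
    where
    square-neg : ∀ x → - x * - x ≡ x * x
    square-neg = solve-∀

  Count-Lower-squares : ∀ {Q n} → Q Respects _≈_ →
    Count p (λ x → Q (x * x) × Lower x) n → Count p (λ s → (IsSquare p s × Q s) × Nonzero s) n
  Count-Lower-squares {Q} Q-resp count =
    Count-image {P = λ x → Q (x * x) × Lower x} {Q = λ s → (IsSquare p s × Q s) × Nonzero s} count square
      injective square∈ onto
    where
    square : Fin p → Fin p
    square r = residue (+ toℕ r * + toℕ r)
    square-≈ : ∀ r → + toℕ (square r) ≈ + toℕ r * + toℕ r
    square-≈ r = residue-≈ (+ toℕ r * + toℕ r)
    square∈ : ∀ r → Q (+ toℕ r * + toℕ r) × Lower (+ toℕ r) →
              (IsSquare p (+ toℕ (square r)) × Q (+ toℕ (square r))) × Nonzero (+ toℕ (square r))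
    square∈ r (Qr² , r<-r) = ((r , ≈⇒≡[mod] (square-≈ r)) , Q-resp (≈-sym (square-≈ r)) Qr²) ,
      Nonzero-resp (≈-sym (square-≈ r)) (*-nonzero (Lower⇒nonzero r r<-r) (Lower⇒nonzero r r<-r))
    injective : ∀ {r s} → Q (+ toℕ r * + toℕ r) × Lower (+ toℕ r) → Q (+ toℕ s * + toℕ s) × Lower (+ toℕ s) →
                square r ≡ square s → r ≡ s
    injective {r} {s} (_ , r<-r) (_ , s<-s) r²≡s² = [ toℕ-≈-injective , r≢-s ]′ (x²≈y²⇒x≈±y r²≈s²)
      where
      r²≈s² : + toℕ r * + toℕ r ≈ + toℕ s * + toℕ s
      r²≈s² = ≈-trans (≈-sym (square-≈ r)) (≈-trans (≈-reflexive (cong (+_ ∘ toℕ) r²≡s²)) (square-≈ s))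
      r≢-s : + toℕ r ≈ - + toℕ s → r ≡ s
      r≢-s r≈-s =
        ⊥-elim (ℕₚ.<-asym (subst (toℕ r <_) (cong toℕ -r≡s) r<-r) (subst (toℕ s <_) (cong toℕ -s≡r) s<-s))
        where
        -s≡r : negate s ≡ r
        -s≡r = ≈-negate⇒≡ r≈-s
        -r≡s : negate r ≡ s
        -r≡s = trans (cong negate (sym -s≡r)) (negate-involutive s)
    onto : ∀ s → (IsSquare p (+ toℕ s) × Q (+ toℕ s)) × Nonzero (+ toℕ s) →
           ∃ λ r → (Q (+ toℕ r * + toℕ r) × Lower (+ toℕ r)) × square r ≡ s
    onto s (((t , s≡t²) , Qs) , s≉0) with trichotomy t
    ... | inj₁ t≈0         = ⊥-elim (s≉0 (≈-trans s≈t² (*-cong t≈0 t≈0)))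
      where s≈t² = ≡[mod]⇒≈ s≡t²
    ... | inj₂ (inj₁ t<-t) = t , (Q-resp s≈t² Qs , t<-t) , trans (residue-cong (≈-sym s≈t²)) (residue-toℕ s)
      where s≈t² = ≡[mod]⇒≈ s≡t²
    ... | inj₂ (inj₂ -t<t) =
      negate t ,
      (Q-resp s≈[-t]² Qs , subst (λ r → toℕ (negate t) < toℕ r) (sym (negate-involutive t)) -t<t) ,
      trans (residue-cong (≈-sym s≈[-t]²)) (residue-toℕ s)
      where s≈[-t]² = ≈-trans (≡[mod]⇒≈ s≡t²) (≈-sym (negate-square t))

  Count-roots : ∀ {Q z a b nR} → Q Respects _≈_ →
    Count p (λ x → x ≈ + 0 × Q x) z →
    Count p (λ x → Q (x * x) × Lower x) a → Count p (λ x → Q (x * x) × Upper x) b →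
    Count p (λ x → Q (x * x)) nR → nR ≡ z ℕ.+ (a ℕ.+ b)
  Count-roots {Q} Q-resp count-Z count-L count-U count-R =
    Count-unique {P = R} count-R
      (Count-≐ {P = Parts} {Q = R} parts⇔R
        (Count-⊎ {P = λ x → x ≈ + 0 × Q x} {Q = λ x → (R x × Lower x) ⊎ (R x × Upper x)} count-Z
          (Count-⊎ {P = λ x → R x × Lower x} {Q = λ x → R x × Upper x} count-L count-U
            λ _ (_ , r<-r) (_ , -r<r) → ℕₚ.<-asym r<-r -r<r)
          λ r (r≈0 , _) → [ (λ (_ , r<-r) → Lower⇒nonzero r r<-r r≈0)
                          , (λ (_ , -r<r) → Upper⇒nonzero r -r<r r≈0) ]′))
    where
    R Parts : ℤ → Set
    R x = Q (x * x)
    Parts x = (x ≈ + 0 × Q x) ⊎ ((R x × Lower x) ⊎ (R x × Upper x))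
    split : ∀ {r} → + toℕ r ≈ + 0 ⊎ Lower (+ toℕ r) ⊎ Upper (+ toℕ r) → R (+ toℕ r) → Parts (+ toℕ r)
    split (inj₁ r≈0)         Rr = inj₁ (r≈0 , Q-resp (≈0⇒x*x≈x r≈0) Rr)
    split (inj₂ (inj₁ r<-r)) Rr = inj₂ (inj₁ (Rr , r<-r))
    split (inj₂ (inj₂ -r<r)) Rr = inj₂ (inj₂ (Rr , -r<r))
    parts⇔R : Parts ≐ R
    parts⇔R r = mk⇔ [ (λ (r≈0 , Qr) → Q-resp (≈-sym (≈0⇒x*x≈x r≈0)) Qr) , [ proj₁ , proj₁ ]′ ]′
                    (split (trichotomy r))

  Count-squares : ∀ {Q z a N} → Q Respects _≈_ →
    Count p (λ x → x ≈ + 0 × Q x) z → Count p (λ x → Q (x * x) × Lower x) a →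
    Count p (λ s → IsSquare p s × Q s) N → N ≡ z ℕ.+ a
  Count-squares {Q} Q-resp count-Z count-L count-S =
    Count-unique {P = S} count-S
      (Count-≐ {P = Parts} {Q = S} parts⇔S
        (Count-⊎ {P = λ s → s ≈ + 0 × Q s} {Q = λ s → S s × Nonzero s} count-Z
          (Count-Lower-squares Q-resp count-L) λ _ (s≈0 , _) (_ , s≉0) → s≉0 s≈0))
    where
    S Parts : ℤ → Set
    S s = IsSquare p s × Q s
    Parts s = (s ≈ + 0 × Q s) ⊎ (S s × Nonzero s)
    split : ∀ {s} → Dec (s ≈ + 0) → S s → Parts s
    split (yes s≈0) (_ , Qs) = inj₁ (s≈0 , Qs)
    split (no  s≉0) Ss       = inj₂ (Ss , s≉0)
    parts⇔S : Parts ≐ S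
    parts⇔S s = mk⇔ [ (λ (s≈0 , Qs) → ≈0⇒square s≈0 , Qs) , proj₁ ]′ (split (≈0? s))

  twice-count-squares : ∀ {Q z nR N} → Q Respects _≈_ →
    Count p (λ x → x ≈ + 0 × Q x) z → Count p (λ x → Q (x * x)) nR →
    Count p (λ s → IsSquare p s × Q s) N → 2 ℕ.* N ≡ z ℕ.+ nR
  twice-count-squares {Q} {z} {nR} {N} Q-resp count-Z count-R count-S = begin
    2 ℕ.* N                   ≡⟨ cong (2 ℕ.*_) (Count-squares Q-resp count-Z (proj₂ lower) count-S) ⟩
    2 ℕ.* (z ℕ.+ a)           ≡⟨ double-sum z a ⟩
    z ℕ.+ (z ℕ.+ (a ℕ.+ a))   ≡⟨ cong (λ c → z ℕ.+ (z ℕ.+ (a ℕ.+ c))) a≡b ⟩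
    z ℕ.+ (z ℕ.+ (a ℕ.+ b))   ≡⟨ cong (z ℕ.+_) (sym (Count-roots Q-resp count-Z (proj₂ lower) (proj₂ upper) count-R)) ⟩
    z ℕ.+ nR                  ∎
    where
    open ≡-Reasoning
    double-sum : ∀ z a → 2 ℕ.* (z ℕ.+ a) ≡ z ℕ.+ (z ℕ.+ (a ℕ.+ a))
    double-sum = ℕ-solve-∀
    R : ℤ → Set
    R x = Q (x * x)
    R-neg : ∀ {x} → R x → R (- x)
    R-neg {x} = Q-resp (≈-reflexive (square-neg x))
      where
      square-neg : ∀ x → x * x ≡ - x * - x
      square-neg = solve-∀
    lower : ∃ λ a → Count p (λ x → R x × Lower x) a
    lower = Count-filter {P = R} {Q = Lower} count-R (λ r → toℕ r ℕ.<? toℕ (negate r))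
    upper : ∃ λ b → Count p (λ x → R x × Upper x) b
    upper = Count-filter {P = R} {Q = Upper} count-R (λ r → toℕ (negate r) ℕ.<? toℕ r)
    a b : ℕ
    a = proj₁ lower
    b = proj₁ upper
    a≡b : a ≡ b
    a≡b = Count-unique {P = λ x → R x × Upper x}
      (Count-Lower⇒Upper {R = R} (λ x≈y → Q-resp (*-cong x≈y x≈y)) (λ {x} → R-neg {x}) (proj₂ lower)) (proj₂ upper)

  Count-affine : ∀ {Q n} → Q Respects _≈_ → (∀ {x} → Q x ⇔ Q (+ 4 * x)) →
    Count p (λ x → Q ((x - + 1) * x)) n → Count p (λ r → Q (r * r - + 1)) n
  Count-affine {Q} Q-resp Q⇔Q[4*] count =
    Count-image {P = λ x → Q ((x - + 1) * x)} {Q = λ r → Q (r * r - + 1)} count f injective f∈ onto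
    where
    open ≈-Reasoning
    f : Fin p → Fin p
    f r = residue (+ 2 * + toℕ r - + 1)
    f-≈ : ∀ r → + toℕ (f r) ≈ + 2 * + toℕ r - + 1
    f-≈ r = residue-≈ (+ 2 * + toℕ r - + 1)
    quadruple : ∀ x → + 4 * ((x - + 1) * x) ≡ (+ 2 * x - + 1) * (+ 2 * x - + 1) - + 1
    quadruple = solve-∀
    Q-square : ∀ x {y} → y ≈ + 2 * x - + 1 → Q ((x - + 1) * x) ⇔ Q (y * y - + 1)
    Q-square x {y} y≈2x-1 = ⇔.trans Q⇔Q[4*] (mk⇔ (Q-resp 4x[x-1]≈y²-1) (Q-resp (≈-sym 4x[x-1]≈y²-1)))
      where
      4x[x-1]≈y²-1 : + 4 * ((x - + 1) * x) ≈ y * y - + 1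
      4x[x-1]≈y²-1 = begin
        + 4 * ((x - + 1) * x)                          ≡⟨ quadruple x ⟩
        (+ 2 * x - + 1) * (+ 2 * x - + 1) - + 1        ≈⟨ +-cong (*-cong (≈-sym y≈2x-1) (≈-sym y≈2x-1)) (≈-refl { - + 1}) ⟩
        y * y - + 1                                    ∎
    f∈ : ∀ r → Q ((+ toℕ r - + 1) * + toℕ r) → Q (+ toℕ (f r) * + toℕ (f r) - + 1)
    f∈ r = to (Q-square (+ toℕ r) (f-≈ r))
    injective : ∀ {r s} → Q ((+ toℕ r - + 1) * + toℕ r) → Q ((+ toℕ s - + 1) * + toℕ s) → f r ≡ f s → r ≡ s
    injective {r} {s} _ _ fr≡fs = toℕ-≈-injective (*-cancelˡ 2-nonzero (begin
      + 2 * + toℕ r               ≡⟨ sym (minus-plus (+ 2 * + toℕ r)) ⟩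
      + 2 * + toℕ r - + 1 + + 1   ≈⟨ +-cong 2r-1≈2s-1 (≈-refl {+ 1}) ⟩
      + 2 * + toℕ s - + 1 + + 1   ≡⟨ minus-plus (+ 2 * + toℕ s) ⟩
      + 2 * + toℕ s               ∎))
      where
      minus-plus : ∀ x → x - + 1 + + 1 ≡ x
      minus-plus = solve-∀
      2r-1≈2s-1 : + 2 * + toℕ r - + 1 ≈ + 2 * + toℕ s - + 1
      2r-1≈2s-1 = ≈-trans (≈-sym (f-≈ r)) (≈-trans (≈-reflexive (cong (+_ ∘ toℕ) fr≡fs)) (f-≈ s))
    onto : ∀ s → Q (+ toℕ s * + toℕ s - + 1) → ∃ λ r → Q ((+ toℕ r - + 1) * + toℕ r) × f r ≡ s
    onto s Q[s²-1] with h , 2h≈1 ← inverse 2-nonzero = r , from (Q-square (+ toℕ r) s≈2r-1) Q[s²-1] ,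
      trans (residue-cong (≈-sym s≈2r-1)) (residue-toℕ s)
      where
      r : Fin p
      r = residue ((+ toℕ s + + 1) * h)
      s≈2r-1 : + toℕ s ≈ + 2 * + toℕ r - + 1
      s≈2r-1 = ≈-sym (begin
        + 2 * + toℕ r - + 1                  ≈⟨ +-cong (*-congˡ (+ 2) (residue-≈ ((+ toℕ s + + 1) * h))) (≈-refl { - + 1}) ⟩
        + 2 * ((+ toℕ s + + 1) * h) - + 1    ≡⟨ regroup (+ toℕ s) h ⟩
        + 2 * h * (+ toℕ s + + 1) - + 1      ≈⟨ +-cong (*-congʳ (+ toℕ s + + 1) 2h≈1) (≈-refl { - + 1}) ⟩
        + 1 * (+ toℕ s + + 1) - + 1          ≡⟨ unit (+ toℕ s) ⟩
        + toℕ s                              ∎)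
        where
        regroup : ∀ s h → + 2 * ((s + + 1) * h) - + 1 ≡ + 2 * h * (s + + 1) - + 1
        regroup = solve-∀
        unit : ∀ s → + 1 * (s + + 1) - + 1 ≡ s
        unit = solve-∀

module SquaresInCosets (p : ℕ) (p-prime : Prime p) (p≢2 : p ≢ 2) (g : ℤ) (g-primitive : PrimitiveRoot p g)
                       (H : ℤ → Set) (H-submonoid : Modular.IsUnitSubmonoid p p-prime H)
                       (nH : ℕ) (count-H : Count p H nH) (4∈H : H (+ 4)) where

  open import Data.Integer using (_+_; _*_)

  open Counting p
  open Modular p p-prime
  open Cosets p p-prime g g-primitive H H-submonoid nH count-H
  open OddPrime p p-prime p≢2

  Count-product-in-coset : ∀ k (a : ℕ → ℕ) →
    (∀ i → Count p (λ x → Coset (+ i) (x - + 1) × Coset (+ k - + i) x) (a i)) →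
    Count p (λ x → Coset (+ k) ((x - + 1) * x)) (sumTo index a)
  Count-product-in-coset k a count-a =
    Count-≐ {P = λ x → ∃ λ i → i < index × C i x} {Q = λ x → Coset (+ k) ((x - + 1) * x)} in-some-C
      (Count-⋃ C a index
        (λ i → Count-≐ {P = λ x → Coset (+ i) (x - + 1) × Coset (+ k - + i) x} {Q = C i} (shift i) (count-a i))
        λ i<j j<index _ (_ , x-1∈gⁱH) (_ , x-1∈gʲH) → Coset-unique i<j j<index x-1∈gⁱH x-1∈gʲH)
    where
    C : ℕ → ℤ → Set
    C i x = Coset (+ k) ((x - + 1) * x) × Coset (+ i) (x - + 1)
    shift : ∀ i → (λ x → Coset (+ i) (x - + 1) × Coset (+ k - + i) x) ≐ C i
    shift i _ = mk⇔ (λ (x-1∈gⁱH , x∈gᵏ⁻ⁱH) → to (Coset-shift i k x-1∈gⁱH) x∈gᵏ⁻ⁱH , x-1∈gⁱH)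
                    (λ (product∈gᵏH , x-1∈gⁱH) → x-1∈gⁱH , from (Coset-shift i k x-1∈gⁱH) product∈gᵏH)
    in-some-C : (λ x → ∃ λ i → i < index × C i x) ≐ (λ x → Coset (+ k) ((x - + 1) * x))
    in-some-C _ = mk⇔ (λ (_ , _ , product∈gᵏH , _) → product∈gᵏH)
      λ product∈gᵏH → let (i , i<index , x-1∈gⁱH) = Coset-exists (*-nonzero⁻ˡ (Coset-nonzero k product∈gᵏH))
                      in i , i<index , product∈gᵏH , x-1∈gⁱH

  twice-count-squares-in-coset : ∀ k (a : ℕ → ℕ) {z N} →
    (∀ i → Count p (λ x → Coset (+ i) (x - + 1) × Coset (+ k - + i) x) (a i)) →
    Count p (λ x → x ≈ + 0 × Coset (+ k) (x - + 1)) z →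
    Count p (λ s → IsSquare p s × Coset (+ k) (s - + 1)) N →
    2 ℕ.* N ≡ z ℕ.+ sumTo index a
  twice-count-squares-in-coset k a count-a count-Z count-S =
    twice-count-squares {Q = λ s → Coset (+ k) (s - + 1)}
      (λ x≈y → Coset-resp (+ k) (+-cong x≈y (≈-refl { - + 1})))
      count-Z
      (Count-affine {Q = Coset (+ k)} (Coset-resp (+ k)) (Coset-*H k 4∈H) (Count-product-in-coset k a count-a))
      count-S

module SubgroupL (p : ℕ) (p-prime : Prime p) (p≢2 : p ≢ 2) where

  open import Data.Integer using (_+_; _*_)

  open Modular p p-prime
  open OddPrime p p-prime p≢2 using (2-nonzero)

  InL-resp : InL p Respects _≈_
  InL-resp x≈y (a , b , x≡) = a , b , ≈⇒≡[mod] (≈-trans (≈-sym x≈y) (≡[mod]⇒≈ x≡))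

  -1∈L : InL p (- + 1)
  -1∈L = 1 , 0 , ≈⇒≡[mod] (≈-refl { - + 1})

  4∈L : InL p (+ 4)
  4∈L = 0 , 2 , ≈⇒≡[mod] (≈-refl {+ 4})

  L-submonoid : IsUnitSubmonoid (InL p)
  L-submonoid = record
    { resp    = InL-resp
    ; one     = 0 , 0 , ≈⇒≡[mod] (≈-refl {+ 1})
    ; mul     = λ {x} {y} → L-mul {x} {y}
    ; nonzero = λ {x} → L-nonzero {x}
    }
    where
    -1-nonzero : Nonzero (- + 1)
    -1-nonzero -1≈0 = 1-nonzero (≈-trans (≈-reflexive refl) (*-congˡ (- + 1) -1≈0))
    L-nonzero : ∀ {x} → InL p x → Nonzero x
    L-nonzero {x} (a , b , x≡) = Nonzero-resp (≈-sym (≡[mod]⇒≈ {x} {(- + 1) ^ a * (+ 2) ^ b} x≡))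
      (*-nonzero (^-nonzero a -1-nonzero) (^-nonzero b 2-nonzero))
    L-mul : ∀ {x y} → InL p x → InL p y → InL p (x * y)
    L-mul {x} {y} (a , b , x≡) (c , d , y≡) = a ℕ.+ c , b ℕ.+ d , ≈⇒≡[mod] (begin
      x * y
        ≈⟨ *-cong (≡[mod]⇒≈ {x} {(- + 1) ^ a * (+ 2) ^ b} x≡) (≡[mod]⇒≈ {y} {(- + 1) ^ c * (+ 2) ^ d} y≡) ⟩
      (- + 1) ^ a * (+ 2) ^ b * ((- + 1) ^ c * (+ 2) ^ d)
        ≡⟨ interchange ((- + 1) ^ a) ((+ 2) ^ b) ((- + 1) ^ c) ((+ 2) ^ d) ⟩
      (- + 1) ^ a * (- + 1) ^ c * ((+ 2) ^ b * (+ 2) ^ d)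
        ≡⟨ sym (cong₂ _*_ (ℤₚ.^-distribˡ-+-* (- + 1) a c) (ℤₚ.^-distribˡ-+-* (+ 2) b d)) ⟩
      (- + 1) ^ (a ℕ.+ c) * (+ 2) ^ (b ℕ.+ d)
        ∎)
      where
      open ≈-Reasoning
      interchange : ∀ a b c d → a * b * (c * d) ≡ a * c * (b * d)
      interchange = solve-∀

module SquaresInShiftedCosetsOfL (p : ℕ) (p-prime : Prime p) (p≢2 : p ≢ 2) (g : ℤ) (g-primitive : PrimitiveRoot p g)
                                 (nL : ℕ) (count-L : Count p (λ x → NonZeroRes p x × InL p x) nL) where

  open import Data.Integer using (_+_; _*_)

  open Counting p
  open Modular p p-prime
  open SubgroupL p p-prime p≢2

  count-InL : Count p (InL p) nL
  count-InL = Count-≐ {P = λ x → NonZeroRes p x × InL p x} {Q = InL p}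
    (λ r → mk⇔ proj₂ (λ r∈L → IsUnitSubmonoid.nonzero L-submonoid r∈L ∘ ≡[mod]⇒≈ {+ toℕ r} {+ 0} , r∈L))
    count-L

  open Cosets p p-prime g g-primitive (InL p) L-submonoid nL count-InL public
  open SquaresInCosets p p-prime p≢2 g g-primitive (InL p) L-submonoid nL count-InL 4∈L

  InCoset⇔Coset : ∀ j {x} → InCoset p g j x ⇔ Coset j x
  InCoset⇔Coset (+ n)    {x} = mk⇔ (λ (y , y∈L , x≡gⁿy) → y , y∈L , ≡[mod]⇒≈ {x} {g ^ n * y} x≡gⁿy)
                                   (λ (y , y∈L , x≈gⁿy) → y , y∈L , ≈⇒≡[mod] x≈gⁿy)
  InCoset⇔Coset -[1+ n ] {x} = mk⇔ (λ (y , y∈L , y≡gⁿx) → y , y∈L , ≡[mod]⇒≈ {y} {g ^ suc n * x} y≡gⁿx)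
                                   (λ (y , y∈L , y≈gⁿx) → y , y∈L , ≈⇒≡[mod] y≈gⁿx)

  InShift1-InCoset⇔ : ∀ j {x} → InShift1 p (InCoset p g j) x ⇔ Coset j (x - + 1)
  InShift1-InCoset⇔ j {x} = ⇔.trans (InShift1⇔ {x = x} InCoset-resp) (InCoset⇔Coset j)
    where
    InCoset-resp : InCoset p g j Respects _≈_
    InCoset-resp {y} {z} y≈z = from (InCoset⇔Coset j {z}) ∘ Coset-resp j y≈z ∘ to (InCoset⇔Coset j {y})

  module _ (A : ℤ → ℤ → ℕ)
           (count-A : (i j : ℤ) → Count p (λ x → InShift1 p (InCoset p g i) x × InCoset p g j x) (A i j)) where

    private
      Q : ℕ → ℤ → Set
      Q k x = Coset (+ k) (x - + 1)

      Q-resp : ∀ k → Q k Respects _≈_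
      Q-resp k x≈y = Coset-resp (+ k) (+-cong x≈y (≈-refl { - + 1}))

      -1∈L-coset : Coset (+ 0) (- + 1)
      -1∈L-coset = from Coset₀⇔H -1∈L

      twice-count-shifted-squares : ∀ k {z N} →
        Count p (λ x → x ≈ + 0 × Q k x) z → Count p (λ x → IsSquare p x × Q k x) N →
        2 ℕ.* N ≡ z ℕ.+ sumTo index (λ i → A (+ i) (+ k - + i))
      twice-count-shifted-squares k =
        twice-count-squares-in-coset k (λ i → A (+ i) (+ k - + i)) λ i →
          Count-≐ {P = λ x → InShift1 p (InCoset p g (+ i)) x × InCoset p g (+ k - + i) x}
                  {Q = λ x → Q i x × Coset (+ k - + i) x}
            (λ r → InShift1-InCoset⇔ (+ i) {+ toℕ r} ×-⇔ InCoset⇔Coset (+ k - + i))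
            (count-A (+ i) (+ k - + i))

    twice-count-squares-in-1+L : ∀ {N} → Count p (λ x → IsSquare p x × InShift1 p (InL p) x) N →
      2 ℕ.* N ≡ 1 ℕ.+ sumTo index (λ i → A (+ i) (+ 0 - + i))
    twice-count-squares-in-1+L count-N =
      twice-count-shifted-squares 0 (Count-≈0 {Q = Q 0} (Q-resp 0) -1∈L-coset)
        (Count-≐ {P = λ x → IsSquare p x × InShift1 p (InL p) x} {Q = λ x → IsSquare p x × Q 0 x}
          (λ r → ⇔.refl ×-⇔ ⇔.trans (InShift1⇔ {x = + toℕ r} InL-resp) (⇔.sym Coset₀⇔H)) count-N)

    twice-count-squares-in-1+gᵏL : ∀ k {N} → 0 < k → k < index →
      Count p (λ x → IsSquare p x × InShift1 p (InCoset p g (+ k)) x) N →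
      2 ℕ.* N ≡ sumTo index (λ i → A (+ i) (+ k - + i))
    twice-count-squares-in-1+gᵏL k 0<k k<index count-N =
      twice-count-shifted-squares k (Count-≉0 {Q = Q k} (Q-resp k) (Coset-unique 0<k k<index -1∈L-coset))
        (Count-≐ {P = λ x → IsSquare p x × InShift1 p (InCoset p g (+ k)) x} {Q = λ x → IsSquare p x × Q k x}
          (λ r → ⇔.refl ×-⇔ InShift1-InCoset⇔ (+ k) {+ toℕ r}) count-N)

open import Data.Nat using (ℕ; _*_; _+_; _∸_; _≤_)
open import Data.Integer using (ℤ; +_; -_; _-_)

lemma4p2 : (p : ℕ) → Prime p → p ≢ 2 →
    (nL ℓ : ℕ) → Count p (λ x → NonZeroRes p x × InL p x) nL →
    ℓ * nL ≡ p ∸ 1 → 3 ≤ ℓ →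
    (g : ℤ) → PrimitiveRoot p g →
    (A : ℤ → ℤ → ℕ) →
    ((i j : ℤ) → Count p (λ x → InShift1 p (InCoset p g i) x × InCoset p g j x) (A i j)) →
    ((N : ℕ) → Count p (λ x → IsSquare p x × InShift1 p (InL p) x) N →
      2 * N ≡ 1 + sumTo ℓ (λ i → A (+ i) (- (+ i))))
    ×
    ((k : ℕ) → 1 ≤ k → k ≤ ℓ ∸ 1 → (N : ℕ) →
      Count p (λ x → IsSquare p x × InShift1 p (InCoset p g (+ k)) x) N →
      2 * N ≡ sumTo ℓ (λ i → A (+ i) (+ k - + i)))
lemma4p2 p p-prime p≢2 nL ℓ count-L ℓ*nL≡p∸1 _ g g-primitive A count-A = squares-in-1+L , squares-in-1+gᵏL
  where
  open ≡-Reasoning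
  open SquaresInShiftedCosetsOfL p p-prime p≢2 g g-primitive nL count-L

  index≡ℓ : index ≡ ℓ
  index≡ℓ = index-unique ℓ ℓ*nL≡p∸1

  squares-in-1+L : (N : ℕ) → Count p (λ x → IsSquare p x × InShift1 p (InL p) x) N →
    2 * N ≡ 1 + sumTo ℓ (λ i → A (+ i) (- (+ i)))
  squares-in-1+L N count-N = begin
    2 * N                                         ≡⟨ twice-count-squares-in-1+L A count-A count-N ⟩
    1 + sumTo index (λ i → A (+ i) (+ 0 - + i))   ≡⟨ cong (λ d → 1 + sumTo d (λ i → A (+ i) (+ 0 - + i))) index≡ℓ ⟩
    1 + sumTo ℓ (λ i → A (+ i) (+ 0 - + i))       ≡⟨ cong suc (sumTo-cong ℓ λ i → cong (A (+ i)) (ℤₚ.+-identityˡ (- + i))) ⟩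
    1 + sumTo ℓ (λ i → A (+ i) (- (+ i)))         ∎

  squares-in-1+gᵏL : (k : ℕ) → 1 ≤ k → k ≤ ℓ ∸ 1 → (N : ℕ) →
    Count p (λ x → IsSquare p x × InShift1 p (InCoset p g (+ k)) x) N →
    2 * N ≡ sumTo ℓ (λ i → A (+ i) (+ k - + i))
  squares-in-1+gᵏL k 1≤k k≤ℓ∸1 N count-N = begin
    2 * N                                         ≡⟨ twice-count-squares-in-1+gᵏL A count-A k 1≤k k<index count-N ⟩
    sumTo index (λ i → A (+ i) (+ k - + i))       ≡⟨ cong (λ d → sumTo d (λ i → A (+ i) (+ k - + i))) index≡ℓ ⟩
    sumTo ℓ (λ i → A (+ i) (+ k - + i))           ∎
    where
    k<index : k < index
    k<index = subst (k <_) (sym index≡ℓ) (m≤n∸1⇒m<n 1≤k k≤ℓ∸1)
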